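{- Let $k\geq 3$ be an integer with $k\equiv 0 \pmod 3$, write $k=3m$, and let $n\geq 1$ be an integer. Let $R_{0}$ be a complete graph on $n$ vertices. For each $1\leq i\leq 2n+1$, let $K_{i}$ be a complete graph on $2m-1$ vertices and let $R_{i}$ be the graph obtained from $K_{i}$ together with $2m+1$ pairwise disjoint copies of $P_{2}$ (disjoint from $K_i$) by joining every vertex of these copies of $P_2$ to every vertex of $K_{i}$; all $R_i$ are pairwise disjoint. Let $H'_{n}=R_{0}+(R_{1}\cup\cdots\cup R_{2n+1})$, where $+$ denotes the join (every vertex of $R_0$ is adjacent to every vertex of $R_1\cup\cdots\cup R_{2n+1}$). Then for all $X\subseteq V(H'_{n})$, $$\sum_{0\leq j\leq k-1}c_{2j+1}(H'_{n}-X)\leq \frac{4k+6}{8k+3}|X|+\frac{2k+3}{8k+3}.$$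
   Context: For a graph $H$ and an integer $i\geq 1$, $c_{i}(H)$ denotes the number of connected components of $H$ having exactly $i$ vertices. $P_{2}$ denotes the path on $2$ vertices (a single edge). The join $H_1+H_2$ of disjoint graphs is obtained from $H_1\cup H_2$ by adding all edges between $V(H_1)$ and $V(H_2)$. -}

module Defs where

open import Data.Nat using (ℕ; zero; suc; _+_; _*_; _∸_; _<_; _≤_)
open import Data.Fin using (Fin)
open import Data.List using (List; _∷_; []; length)
open import Data.List.Membership.Propositional using (_∈_; _∉_)
open import Data.List.Relation.Unary.Unique.Propositional using (Unique)
open import Data.List.Relation.Unary.All using (All)
open import Data.List.Relation.Unary.AllPairs using (AllPairs)
open import Data.Product using (Σ; _×_; Σ-syntax)
open import Data.Empty using (⊥)
open import Data.Unit using (⊤)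
open import Relation.Binary.PropositionalEquality using (_≡_; _≢_)
open import Relation.Nullary using (¬_)

-- Vertex set of H'_n, with k = 3m.
--   r0 a       : vertex a of R_0 = K_n
--   kv i a     : vertex a of the clique K_i (2m-1 vertices), i ∈ {1..2n+1} ↦ Fin (2n+1)
--   pv i p s   : endpoint s ∈ {0,1} of the p-th copy of P_2 in R_i (2m+1 copies)
data V (n m : ℕ) : Set where
  r0 : Fin n → V n m
  kv : Fin (suc (2 * n)) → Fin (2 * m ∸ 1) → V n m
  pv : Fin (suc (2 * n)) → Fin (suc (2 * m)) → Fin 2 → V n m

Adj : ∀ {n m} → V n m → V n m → Set
Adj (r0 a)     (r0 b)     = a ≢ b
Adj (r0 _)     (kv _ _)   = ⊤
Adj (r0 _)     (pv _ _ _) = ⊤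
Adj (kv _ _)   (r0 _)     = ⊤
Adj (pv _ _ _) (r0 _)     = ⊤
Adj (kv i a)   (kv j b)   = i ≡ j × a ≢ b
Adj (kv i _)   (pv j _ _) = i ≡ j
Adj (pv i _ _) (kv j _)   = i ≡ j
Adj (pv i p s) (pv j q t) = i ≡ j × p ≡ q × s ≢ t

-- Reachability in G - X (walks using only vertices outside X; start vertex
-- is assumed outside X by the caller).
data Reach {n m : ℕ} (X : List (V n m)) : V n m → V n m → Set where
  here : ∀ {u} → Reach X u u
  step : ∀ {u w v} → Adj u w → w ∉ X → Reach X w v → Reach X u v

IsComponent : ∀ {n m} → List (V n m) → List (V n m) → Set
IsComponent {n} {m} X C =
  Unique C
  × (Σ[ v ∈ V n m ] v ∈ C)
  × (∀ {v} → v ∈ C → v ∉ X)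
  × (∀ {u v} → u ∈ C → v ∈ C → Reach X u v)
  × (∀ {u w} → u ∈ C → Adj u w → w ∉ X → w ∈ C)

SameSet : ∀ {n m} → List (V n m) → List (V n m) → Set
SameSet C D = (∀ {v} → v ∈ C → v ∈ D) × (∀ {v} → v ∈ D → v ∈ C)

OddBelow : ℕ → ℕ → Set
OddBelow k s = Σ[ j ∈ ℕ ] j < k × s ≡ suc (2 * j)

-- Multiplying by 3, the claim is (8m+1)c ≤ (4m+2)|X| + (2m+1) for c counted components.
-- If some vertex of R₀ survives, it lies in every component, so c ≤ 1; and a component
-- then contains all survivors of R₁, which has 6m+1 vertices against at most 6m-1 in the
-- component, so |X| ≥ 2. Otherwise every component lies inside a single block R_j and we
-- prove the same inequality block by block. If a vertex of K_j survives, the same argument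
-- applies within R_j. If K_j ⊆ X, a component of R_j - X lies inside one copy of P₂, so
-- being odd it is a single vertex whose partner is in X; hence c_j ≤ 2m+1 and
-- |X ∩ R_j| ≥ 2m-1 + c_j, which is exactly enough. Summing over the 2n+1 blocks costs
-- (2m+1)(2n+1), and the n vertices of R₀ in X pay (4m+2)n for the excess.
module Submission where

open import Defs
open import Data.Nat using (ℕ; zero; suc; _+_; _*_; _∸_; _≤_; _<_; z≤n; s≤s; _<?_)
import Data.Nat as ℕ
open import Data.Nat.Properties
open import Data.Nat.Tactic.RingSolver using (solve-∀)
open import Data.Fin as Fin using (Fin; toℕ; fromℕ<)
open import Data.Fin.Properties using (toℕ-injective; toℕ<n; toℕ-fromℕ<; all?; ¬∀⟶∃¬)
open import Data.List using (List; []; _∷_; length; filter; map; _++_; allFin)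
open import Data.List.Properties
  using (length-++; length-map; length-tabulate; filter-all; filter-notAll)
open import Data.List.Membership.Propositional using (_∈_; _∉_)
open import Data.List.Membership.Propositional.Properties
  using (∈-filter⁺; ∈-filter⁻; ∈-map⁺; ∈-map⁻; ∈-++⁺ˡ; ∈-++⁺ʳ; ∈-++⁻; ∈-allFin)
open import Data.List.Relation.Binary.Subset.Propositional using (_⊆_)
open import Data.List.Relation.Binary.Disjoint.Propositional using (Disjoint)
open import Data.List.Relation.Unary.Any as Any using (here; there; any?)
open import Data.List.Relation.Unary.All as All using (All; []; _∷_)
import Data.List.Relation.Unary.All.Properties as Allₚ
open import Data.List.Relation.Unary.AllPairs using (AllPairs; []; _∷_)
import Data.List.Relation.Unary.AllPairs.Properties as AllPairsₚ
open import Data.List.Relation.Unary.Unique.Propositional using (Unique)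
import Data.List.Relation.Unary.Unique.Propositional.Properties as Uniqueₚ
open import Data.Product using (Σ-syntax; _×_; _,_; proj₁; proj₂)
open import Data.Sum using (_⊎_; inj₁; inj₂; [_,_])
open import Data.Empty using (⊥; ⊥-elim)
open import Data.Unit using (tt)
open import Function using (_∘_)
open import Relation.Binary using (DecidableEquality; tri<; tri≈; tri>)
open import Relation.Binary.PropositionalEquality hiding ([_])
open import Relation.Nullary using (¬_; Dec; yes; no; ¬?)
open import Relation.Nullary.Decidable using (dec-true; dec-false)

module _ {A : Set} (_≟_ : DecidableEquality A) where

  unique-⊆⇒length≤ : ∀ {xs ys : List A} → Unique xs → xs ⊆ ys → length xs ≤ length ys
  unique-⊆⇒length≤ {[]} _ _ = z≤n
  unique-⊆⇒length≤ {x ∷ xs} {ys} (x∉xs ∷ uxs) xs⊆ys =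
    ≤-trans (s≤s (unique-⊆⇒length≤ uxs xs⊆ys-x))
      (filter-notAll (¬? ∘ (_≟ x)) ys (Any.map (λ x≡y y≢x → y≢x (sym x≡y)) (xs⊆ys (here refl))))
    where
    xs⊆ys-x : xs ⊆ filter (¬? ∘ (_≟ x)) ys
    xs⊆ys-x v∈xs = ∈-filter⁺ (¬? ∘ (_≟ x)) (xs⊆ys (there v∈xs)) (All.lookup x∉xs v∈xs ∘ sym)

  disjoint-⊆⇒length-+≤ : ∀ {xs ys zs : List A} → Unique xs → Unique ys → Disjoint xs ys →
    xs ⊆ zs → ys ⊆ zs → length xs + length ys ≤ length zs
  disjoint-⊆⇒length-+≤ {xs} uxs uys xs#ys xs⊆zs ys⊆zs =
    subst (_≤ _) (length-++ xs)
      (unique-⊆⇒length≤ (Uniqueₚ.++⁺ uxs uys xs#ys) ([ xs⊆zs , ys⊆zs ] ∘ ∈-++⁻ xs))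

length-allFin : ∀ k → length (allFin k) ≡ k
length-allFin k = length-tabulate (λ a → a)

allPairs-mapWith : ∀ {A : Set} {P : A → Set} {R S : A → A → Set} →
  (∀ {x y} → P x → P y → R x y → S x y) → ∀ {xs} → All P xs → AllPairs R xs → AllPairs S xs
allPairs-mapWith f [] [] = []
allPairs-mapWith f (px ∷ pxs) (rx ∷ rxs) =
  All.zipWith (λ (py , r) → f px py r) (pxs , rx) ∷ allPairs-mapWith f pxs rxs

allPairs-⊥⇒length≤1 : ∀ {A : Set} {xs : List A} → AllPairs (λ _ _ → ⊥) xs → length xs ≤ 1
allPairs-⊥⇒length≤1 [] = z≤n
allPairs-⊥⇒length≤1 ([] ∷ _) = s≤s z≤n
allPairs-⊥⇒length≤1 ((() ∷ _) ∷ _)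

module _ {A : Set} (f : A → ℕ) where

  countBelow countAt : ℕ → List A → ℕ
  countBelow k xs = length (filter (λ x → f x <? k) xs)
  countAt k xs = length (filter (λ x → f x ℕ.≟ k) xs)

  countBelow-zero : ∀ xs → countBelow 0 xs ≡ 0
  countBelow-zero [] = refl
  countBelow-zero (x ∷ xs) rewrite dec-false (f x <? 0) (λ ()) = countBelow-zero xs

  countBelow-suc : ∀ k xs → countBelow (suc k) xs ≡ countBelow k xs + countAt k xs
  countBelow-suc k [] = refl
  countBelow-suc k (x ∷ xs) with <-cmp (f x) k
  ... | tri< fx<k fx≢k _
    rewrite dec-true (f x <? suc k) (m<n⇒m<1+n fx<k) | dec-true (f x <? k) fx<k
          | dec-false (f x ℕ.≟ k) fx≢k
    = cong suc (countBelow-suc k xs)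
  ... | tri≈ fx≮k refl _
    rewrite dec-true (f x <? suc k) ≤-refl | dec-false (f x <? k) fx≮k
          | dec-true (f x ℕ.≟ k) refl
    = trans (cong suc (countBelow-suc k xs)) (sym (+-suc _ _))
  ... | tri> fx≮k fx≢k k<fx
    rewrite dec-false (f x <? suc k) (<⇒≱ k<fx ∘ m<1+n⇒m≤n) | dec-false (f x <? k) fx≮k
          | dec-false (f x ℕ.≟ k) fx≢k
    = countBelow-suc k xs

-- Three times Bound m c x 1 is the inequality of the theorem for k = 3m; t counts the blocks
-- whose bounds have been added up.
Bound : ℕ → ℕ → ℕ → ℕ → Set
Bound m c x t = (8 * m + 1) * c ≤ (4 * m + 2) * x + (2 * m + 1) * t

module _ (m : ℕ) where

  bound-zero : ∀ x t → Bound m 0 x t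
  bound-zero x t rewrite *-zeroʳ (8 * m + 1) = z≤n

  bound-single : ∀ {x} → 2 ≤ x → Bound m 1 x 1
  bound-single {x} 2≤x = begin
    (8 * m + 1) * 1                  ≤⟨ m≤m+n _ 3 ⟩
    (8 * m + 1) * 1 + 3              ≡⟨ identity m ⟩
    (4 * m + 2) * 2                  ≤⟨ *-monoʳ-≤ (4 * m + 2) 2≤x ⟩
    (4 * m + 2) * x                  ≤⟨ m≤m+n _ _ ⟩
    (4 * m + 2) * x + (2 * m + 1) * 1 ∎
    where
    open ≤-Reasoning
    identity : ∀ m → (8 * m + 1) * 1 + 3 ≡ (4 * m + 2) * 2
    identity = solve-∀

  bound-≤1 : ∀ {c x} → c ≤ 1 → (1 ≤ c → 2 ≤ x) → Bound m c x 1
  bound-≤1 {zero} _ _ = bound-zero _ 1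
  bound-≤1 {suc zero} _ 2≤x = bound-single (2≤x ≤-refl)
  bound-≤1 {suc (suc _)} (s≤s ()) _

  bound-+ : ∀ {c c′ x x′ t t′} → Bound m c x t → Bound m c′ x′ t′ →
    Bound m (c + c′) (x + x′) (t + t′)
  bound-+ {c} {c′} {x} {x′} {t} {t′} b b′ = begin
    (8 * m + 1) * (c + c′)                            ≡⟨ *-distribˡ-+ (8 * m + 1) c c′ ⟩
    (8 * m + 1) * c + (8 * m + 1) * c′                ≤⟨ +-mono-≤ b b′ ⟩
    ((4 * m + 2) * x + (2 * m + 1) * t) + ((4 * m + 2) * x′ + (2 * m + 1) * t′)
                                                      ≡⟨ regroup m x x′ t t′ ⟩
    (4 * m + 2) * (x + x′) + (2 * m + 1) * (t + t′)   ∎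
    where
    open ≤-Reasoning
    regroup : ∀ m x x′ t t′ →
      ((4 * m + 2) * x + (2 * m + 1) * t) + ((4 * m + 2) * x′ + (2 * m + 1) * t′)
        ≡ (4 * m + 2) * (x + x′) + (2 * m + 1) * (t + t′)
    regroup = solve-∀

  -- (4m+2)n = (2m+1)·2n: n extra vertices of X pay for 2n extra units of (2m+1).
  bound-absorb : ∀ {c x x′} n → Bound m c x (suc (2 * n)) → x + n ≤ x′ → Bound m c x′ 1
  bound-absorb {c} {x} {x′} n b x+n≤x′ = begin
    (8 * m + 1) * c                          ≤⟨ b ⟩
    (4 * m + 2) * x + (2 * m + 1) * suc (2 * n) ≡⟨ regroup m n x ⟩
    (4 * m + 2) * (x + n) + (2 * m + 1) * 1  ≤⟨ +-monoˡ-≤ _ (*-monoʳ-≤ (4 * m + 2) x+n≤x′) ⟩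
    (4 * m + 2) * x′ + (2 * m + 1) * 1       ∎
    where
    open ≤-Reasoning
    regroup : ∀ m n x →
      (4 * m + 2) * x + (2 * m + 1) * suc (2 * n) ≡ (4 * m + 2) * (x + n) + (2 * m + 1) * 1
    regroup = solve-∀

  bound-sum : ∀ {A B : Set} (f : A → ℕ) (g : B → ℕ) xs ys N →
    (∀ k → k < N → Bound m (countAt f k xs) (countAt g k ys) 1) →
    Bound m (countBelow f N xs) (countBelow g N ys) N
  bound-sum f g xs ys zero _ rewrite countBelow-zero f xs = bound-zero _ 0
  bound-sum f g xs ys (suc N) b rewrite countBelow-suc f N xs | countBelow-suc g N ys =
    subst (Bound m _ _) (+-comm N 1)
      (bound-+ (bound-sum f g xs ys N (λ k k<N → b k (m<n⇒m<1+n k<N))) (b N ≤-refl))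

  bound⇒theorem : ∀ {c x} → Bound m c x 1 →
    (8 * (3 * m) + 3) * c ≤ (4 * (3 * m) + 6) * x + (2 * (3 * m) + 3)
  bound⇒theorem {c} {x} b = subst₂ _≤_ (lhs m c) (rhs m x) (*-monoʳ-≤ 3 b)
    where
    lhs : ∀ m c → 3 * ((8 * m + 1) * c) ≡ (8 * (3 * m) + 3) * c
    lhs = solve-∀
    rhs : ∀ m x →
      3 * ((4 * m + 2) * x + (2 * m + 1) * 1) ≡ (4 * (3 * m) + 6) * x + (2 * (3 * m) + 3)
    rhs = solve-∀

2*suc∸1 : ∀ m → 2 * suc m ∸ 1 ≡ suc (2 * m)
2*suc∸1 m = +-suc m (m + 0)

-- Tight: at c = 2m+1 and x = 4m both sides equal 16m²+10m+1.
bound-pendants : ∀ m {c x} → 1 ≤ m → c + c ≤ suc (2 * m) + suc (2 * m) → (2 * m ∸ 1) + c ≤ x →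
  Bound m c x 1
bound-pendants (suc m) {c} {x} _ c+c≤ K+c≤x = begin
  (8 * suc m + 1) * c                                       ≡⟨ split m c ⟩
  (4 * suc m + 2) * c + (4 * m + 3) * c                     ≤⟨ +-monoʳ-≤ _ (*-monoʳ-≤ (4 * m + 3) c≤) ⟩
  (4 * suc m + 2) * c + (4 * m + 3) * suc (2 * suc m)       ≡⟨ regroup m c ⟩
  (4 * suc m + 2) * (c + suc (2 * m)) + (2 * suc m + 1) * 1 ≤⟨ +-monoˡ-≤ _ (*-monoʳ-≤ (4 * suc m + 2) c+K≤x) ⟩
  (4 * suc m + 2) * x + (2 * suc m + 1) * 1                 ∎
  where
  open ≤-Reasoning
  split : ∀ m c → (8 * suc m + 1) * c ≡ (4 * suc m + 2) * c + (4 * m + 3) * c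
  split = solve-∀
  regroup : ∀ m c → (4 * suc m + 2) * c + (4 * m + 3) * suc (2 * suc m)
    ≡ (4 * suc m + 2) * (c + suc (2 * m)) + (2 * suc m + 1) * 1
  regroup = solve-∀
  c≤ : c ≤ suc (2 * suc m)
  c≤ = ≮⇒≥ (λ s<c → <⇒≱ (+-mono-< s<c s<c) c+c≤)
  c+K≤x : c + suc (2 * m) ≤ x
  c+K≤x = subst (_≤ x) (trans (cong (_+ c) (2*suc∸1 m)) (+-comm _ c)) K+c≤x

odd<2* : ∀ {k l} → OddBelow k l → l < 2 * k
odd<2* {k} (j , j<k , refl) = subst (_≤ 2 * k) (*-suc 2 j) (*-monoʳ-≤ 2 j<k)

¬odd-2 : ∀ {k} → ¬ OddBelow k 2
¬odd-2 (zero , _ , ())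
¬odd-2 (suc j , _ , 2≡) = 0≢1+n (trans (suc-injective (suc-injective 2≡)) (+-suc j (j + 0)))

other : Fin 2 → Fin 2
other Fin.zero = Fin.suc Fin.zero
other (Fin.suc Fin.zero) = Fin.zero

≢-other : ∀ s → s ≢ other s
≢-other Fin.zero ()
≢-other (Fin.suc Fin.zero) ()

other-involutive : ∀ s → other (other s) ≡ s
other-involutive Fin.zero = refl
other-involutive (Fin.suc Fin.zero) = refl

module _ {n m : ℕ} where

  _≟V_ : DecidableEquality (V n m)
  r0 a ≟V r0 b with a Fin.≟ b
  ... | yes refl = yes refl
  ... | no a≢b = no λ { refl → a≢b refl }
  r0 _ ≟V kv _ _ = no λ ()
  r0 _ ≟V pv _ _ _ = no λ ()
  kv _ _ ≟V r0 _ = no λ ()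
  kv i a ≟V kv j b with i Fin.≟ j | a Fin.≟ b
  ... | yes refl | yes refl = yes refl
  ... | no i≢j | _ = no λ { refl → i≢j refl }
  ... | _ | no a≢b = no λ { refl → a≢b refl }
  kv _ _ ≟V pv _ _ _ = no λ ()
  pv _ _ _ ≟V r0 _ = no λ ()
  pv _ _ _ ≟V kv _ _ = no λ ()
  pv i p s ≟V pv j q t with i Fin.≟ j | p Fin.≟ q | s Fin.≟ t
  ... | yes refl | yes refl | yes refl = yes refl
  ... | no i≢j | _ | _ = no λ { refl → i≢j refl }
  ... | _ | no p≢q | _ = no λ { refl → p≢q refl }
  ... | _ | _ | no s≢t = no λ { refl → s≢t refl }

  _∈?_ : ∀ v (X : List (V n m)) → Dec (v ∈ X)
  v ∈? X = any? (v ≟V_) X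

  Adj-sym : ∀ {u v : V n m} → Adj u v → Adj v u
  Adj-sym {r0 _} {r0 _} a≢b = a≢b ∘ sym
  Adj-sym {r0 _} {kv _ _} _ = tt
  Adj-sym {r0 _} {pv _ _ _} _ = tt
  Adj-sym {kv _ _} {r0 _} _ = tt
  Adj-sym {kv _ _} {kv _ _} (i≡j , a≢b) = sym i≡j , a≢b ∘ sym
  Adj-sym {kv _ _} {pv _ _ _} i≡j = sym i≡j
  Adj-sym {pv _ _ _} {r0 _} _ = tt
  Adj-sym {pv _ _ _} {kv _ _} i≡j = sym i≡j
  Adj-sym {pv _ _ _} {pv _ _ _} (i≡j , p≡q , s≢t) = sym i≡j , sym p≡q , s≢t ∘ sym

  Dominates : V n m → V n m → Set
  Dominates v w = v ≡ w ⊎ Adj v w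

  dominates-sym : ∀ {v w} → Dominates v w → Dominates w v
  dominates-sym (inj₁ v≡w) = inj₁ (sym v≡w)
  dominates-sym (inj₂ adj) = inj₂ (Adj-sym adj)

  partner : V n m → V n m
  partner (pv i p s) = pv i p (other s)
  partner v = v

  partner-involutive : ∀ v → partner (partner v) ≡ v
  partner-involutive (r0 _) = refl
  partner-involutive (kv _ _) = refl
  partner-involutive (pv i p s) = cong (pv i p) (other-involutive s)

  partner-injective : ∀ {u v} → partner u ≡ partner v → u ≡ v
  partner-injective {u} {v} eq =
    trans (sym (partner-involutive u)) (trans (cong partner eq) (partner-involutive v))

  -- The index of the block R_{j+1} containing a vertex; R₀ gets the out-of-range index 2n+1.
  block : V n m → ℕ
  block (r0 _) = suc (2 * n)
  block (kv i _) = toℕ i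
  block (pv i _ _) = toℕ i

  -- A component is classified by its first vertex; the default for [] is never used.
  first : List (V n m) → V n m
  first [] = pv Fin.zero Fin.zero Fin.zero
  first (v ∷ _) = v

  cliqueOf : Fin (suc (2 * n)) → List (V n m)
  cliqueOf j = map (kv j) (allFin (2 * m ∸ 1))

  sideOf : Fin (suc (2 * n)) → Fin 2 → List (V n m)
  sideOf j s = map (λ p → pv j p s) (allFin (suc (2 * m)))

  matchingOf : Fin (suc (2 * n)) → List (V n m)
  matchingOf j = sideOf j Fin.zero ++ sideOf j (Fin.suc Fin.zero)

  blockOf : Fin (suc (2 * n)) → List (V n m)
  blockOf j = cliqueOf j ++ matchingOf j

  pairOf : Fin (suc (2 * n)) → Fin (suc (2 * m)) → List (V n m)
  pairOf j p = pv j p Fin.zero ∷ pv j p (Fin.suc Fin.zero) ∷ []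

  length-cliqueOf : ∀ j → length (cliqueOf j) ≡ 2 * m ∸ 1
  length-cliqueOf j =
    trans (length-map (kv {n} {m} j) (allFin (2 * m ∸ 1))) (length-allFin (2 * m ∸ 1))

  length-matchingOf : ∀ j → length (matchingOf j) ≡ suc (2 * m) + suc (2 * m)
  length-matchingOf j = trans (length-++ (sideOf j Fin.zero)) (cong₂ _+_ (side Fin.zero) (side _))
    where
    side : ∀ s → length (sideOf j s) ≡ suc (2 * m)
    side s =
      trans (length-map (λ p → pv {n} {m} j p s) (allFin (suc (2 * m)))) (length-allFin (suc (2 * m)))

  length-blockOf : 1 ≤ m → ∀ j → length (blockOf j) ≡ suc (2 * (3 * m))
  length-blockOf 1≤m j = begin
    length (blockOf j)                          ≡⟨ length-++ (cliqueOf j) ⟩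
    length (cliqueOf j) + length (matchingOf j) ≡⟨ cong₂ _+_ (length-cliqueOf j) (length-matchingOf j) ⟩
    (2 * m ∸ 1) + (suc (2 * m) + suc (2 * m))   ≡⟨ count 1≤m ⟩
    suc (2 * (3 * m))                           ∎
    where
    open ≡-Reasoning
    total : ∀ m → suc (2 * m) + (suc (2 * suc m) + suc (2 * suc m)) ≡ suc (2 * (3 * suc m))
    total = solve-∀
    count : ∀ {m} → 1 ≤ m → (2 * m ∸ 1) + (suc (2 * m) + suc (2 * m)) ≡ suc (2 * (3 * m))
    count {suc m} _ = trans (cong (_+ (suc (2 * suc m) + suc (2 * suc m))) (2*suc∸1 m)) (total m)

  pv∈matchingOf : ∀ j p s → pv j p s ∈ matchingOf j
  pv∈matchingOf j p Fin.zero = ∈-++⁺ˡ (∈-map⁺ _ (∈-allFin p))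
  pv∈matchingOf j p (Fin.suc Fin.zero) = ∈-++⁺ʳ (sideOf j Fin.zero) (∈-map⁺ _ (∈-allFin p))

  pv∈pairOf : ∀ j p s → pv j p s ∈ pairOf j p
  pv∈pairOf j p Fin.zero = here refl
  pv∈pairOf j p (Fin.suc Fin.zero) = there (here refl)

  ∈-cliqueOf⁻ : ∀ {j w} → w ∈ cliqueOf j → Σ[ a ∈ Fin (2 * m ∸ 1) ] w ≡ kv j a
  ∈-cliqueOf⁻ w∈ with ∈-map⁻ _ w∈
  ... | a , _ , w≡ = a , w≡

  ∈-matchingOf⁻ : ∀ {j w} → w ∈ matchingOf j →
    Σ[ p ∈ Fin (suc (2 * m)) ] Σ[ s ∈ Fin 2 ] w ≡ pv j p s
  ∈-matchingOf⁻ {j} w∈ with ∈-++⁻ (sideOf j Fin.zero) w∈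
  ... | inj₁ w∈side with ∈-map⁻ _ w∈side
  ...   | p , _ , w≡ = p , Fin.zero , w≡
  ∈-matchingOf⁻ {j} w∈ | inj₂ w∈side with ∈-map⁻ _ w∈side
  ...   | p , _ , w≡ = p , Fin.suc Fin.zero , w≡

  partner-∈matchingOf : ∀ {j w} → w ∈ matchingOf j → partner w ∈ matchingOf j
  partner-∈matchingOf {j} w∈ with ∈-matchingOf⁻ w∈
  ... | p , s , refl = pv∈matchingOf j p (other s)

  cliqueOf-disjoint-matchingOf : ∀ j → Disjoint (cliqueOf j) (matchingOf j)
  cliqueOf-disjoint-matchingOf j (w∈K , w∈M) with ∈-cliqueOf⁻ w∈K | ∈-matchingOf⁻ w∈M
  ... | _ , refl | _ , _ , ()

  unique-cliqueOf : ∀ j → Unique (cliqueOf j)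
  unique-cliqueOf j = Uniqueₚ.map⁺ (λ { refl → refl }) (Uniqueₚ.allFin⁺ _)

  unique-matchingOf : ∀ j → Unique (matchingOf j)
  unique-matchingOf j = Uniqueₚ.++⁺ (side Fin.zero) (side _) sides-disjoint
    where
    side : ∀ s → Unique (sideOf j s)
    side s = Uniqueₚ.map⁺ (λ { refl → refl }) (Uniqueₚ.allFin⁺ _)
    sides-disjoint : Disjoint (sideOf j Fin.zero) (sideOf j (Fin.suc Fin.zero))
    sides-disjoint (w∈₀ , w∈₁) with ∈-map⁻ _ w∈₀ | ∈-map⁻ _ w∈₁
    ... | _ , _ , refl | _ , _ , ()

  unique-blockOf : ∀ j → Unique (blockOf j)
  unique-blockOf j =
    Uniqueₚ.++⁺ (unique-cliqueOf j) (unique-matchingOf j) (cliqueOf-disjoint-matchingOf j)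

  unique-pairOf : ∀ j p s → Unique (pv {n} {m} j p s ∷ pv j p (other s) ∷ [])
  unique-pairOf j p s = ((≢-other s ∘ side-injective) ∷ []) ∷ [] ∷ []
    where
    side-injective : ∀ {t} → pv j p s ≡ pv j p t → s ≡ t
    side-injective refl = refl

  block-∈blockOf : ∀ {j w} → w ∈ blockOf j → block w ≡ toℕ j
  block-∈blockOf {j} w∈ with ∈-++⁻ (cliqueOf j) w∈
  ... | inj₁ w∈K with ∈-cliqueOf⁻ w∈K
  ...   | _ , refl = refl
  block-∈blockOf {j} w∈ | inj₂ w∈M with ∈-matchingOf⁻ w∈M
  ...   | _ , _ , refl = refl

  block≡⇒kv⊎pv : ∀ {j} w → block w ≡ toℕ j →
    (Σ[ a ∈ Fin (2 * m ∸ 1) ] w ≡ kv j a) ⊎ (Σ[ p ∈ Fin (suc (2 * m)) ] Σ[ s ∈ Fin 2 ] w ≡ pv j p s)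
  block≡⇒kv⊎pv {j} (r0 _) eq = ⊥-elim (<-irrefl (sym eq) (toℕ<n j))
  block≡⇒kv⊎pv (kv i a) eq with toℕ-injective eq
  ... | refl = inj₁ (a , refl)
  block≡⇒kv⊎pv (pv i p s) eq with toℕ-injective eq
  ... | refl = inj₂ (p , s , refl)

  r0-dominates : ∀ a w → Dominates (r0 a) w
  r0-dominates a (r0 b) with a Fin.≟ b
  ... | yes a≡b = inj₁ (cong r0 a≡b)
  ... | no a≢b = inj₂ a≢b
  r0-dominates a (kv _ _) = inj₂ tt
  r0-dominates a (pv _ _ _) = inj₂ tt

  kv-dominates : ∀ j a w → block w ≡ toℕ j → Dominates (kv j a) w
  kv-dominates j a w eq with block≡⇒kv⊎pv w eq
  ... | inj₂ (_ , _ , refl) = inj₂ refl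
  ... | inj₁ (b , refl) with a Fin.≟ b
  ...   | yes refl = inj₁ refl
  ...   | no a≢b = inj₂ (refl , a≢b)

  module _ {X : List (V n m)} where

    component-unique : ∀ {C} → IsComponent X C → Unique C
    component-unique (uC , _) = uC

    component-avoids : ∀ {C v} → IsComponent X C → v ∈ C → v ∉ X
    component-avoids (_ , _ , avoids , _) = avoids

    component-connected : ∀ {C u v} → IsComponent X C → u ∈ C → v ∈ C → Reach X u v
    component-connected (_ , _ , _ , connected , _) = connected

    component-closed : ∀ {C u w} → IsComponent X C → u ∈ C → Adj u w → w ∉ X → w ∈ C
    component-closed (_ , _ , _ , _ , closed) = closed

    first∈ : ∀ {C} → IsComponent X C → first C ∈ C
    first∈ {[]} (_ , (_ , ()) , _)
    first∈ {_ ∷ _} _ = here refl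

    reach-closed : ∀ {C u v} → IsComponent X C → u ∈ C → Reach X u v → v ∈ C
    reach-closed isC u∈C here = u∈C
    reach-closed isC u∈C (step adj w∉X r) = reach-closed isC (component-closed isC u∈C adj w∉X) r

    dominated-∈ : ∀ {C v w} → IsComponent X C → v ∈ C → w ∉ X → Dominates v w → w ∈ C
    dominated-∈ isC v∈C _ (inj₁ refl) = v∈C
    dominated-∈ isC v∈C w∉X (inj₂ adj) = component-closed isC v∈C adj w∉X

    shared-vertex⇒SameSet : ∀ {C D v} → IsComponent X C → IsComponent X D → v ∈ C → v ∈ D →
      SameSet C D
    shared-vertex⇒SameSet isC isD v∈C v∈D =
      (λ u∈C → reach-closed isD v∈D (component-connected isC v∈C u∈C)) ,
      (λ u∈D → reach-closed isC v∈C (component-connected isD v∈D u∈D))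

    distinct-components-distinct-firsts : ∀ {Cs} → All (IsComponent X) Cs →
      AllPairs (λ C D → ¬ SameSet C D) Cs → Unique (map first Cs)
    distinct-components-distinct-firsts comps distinct =
      AllPairsₚ.map⁺ (allPairs-mapWith firsts-differ comps distinct)
      where
      firsts-differ : ∀ {C D} → IsComponent X C → IsComponent X D → ¬ SameSet C D →
        first C ≢ first D
      firsts-differ {D = D} isC isD ¬same eq =
        ¬same (shared-vertex⇒SameSet isC isD (first∈ isC) (subst (_∈ D) (sym eq) (first∈ isD)))

    at-most-one-component-through : ∀ {v Cs} → All (IsComponent X) Cs →
      AllPairs (λ C D → ¬ SameSet C D) Cs → All (v ∈_) Cs → length Cs ≤ 1
    at-most-one-component-through comps distinct v∈Cs = allPairs-⊥⇒length≤1
      (allPairs-mapWith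
        (λ (isC , v∈C) (isD , v∈D) ¬same → ¬same (shared-vertex⇒SameSet isC isD v∈C v∈D))
        (All.zip (comps , v∈Cs)) distinct)

    -- The vertices of W outside X all join the component of v.
    dominated-length≤ : ∀ {C v W Y} → IsComponent X C → v ∈ C → Unique W → All (Dominates v) W →
      (∀ {w} → w ∈ W → w ∈ X → w ∈ Y) → length W ≤ length C + length Y
    dominated-length≤ {C} {v} {W} {Y} isC v∈C uW dom W∩X⊆Y =
      subst (length W ≤_) (length-++ C) (unique-⊆⇒length≤ _≟V_ uW W⊆C++Y)
      where
      W⊆C++Y : W ⊆ C ++ Y
      W⊆C++Y {w} w∈W with w ∈? X
      ... | yes w∈X = ∈-++⁺ʳ C (W∩X⊆Y w∈W w∈X)
      ... | no w∉X = ∈-++⁺ˡ (dominated-∈ isC v∈C w∉X (All.lookup dom w∈W))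

    dominated-component⇒2≤ : 1 ≤ m → ∀ {C v} j {Y} → IsComponent X C → OddBelow (3 * m) (length C) →
      v ∈ C → All (Dominates v) (blockOf j) → (∀ {w} → w ∈ blockOf j → w ∈ X → w ∈ Y) → 2 ≤ length Y
    dominated-component⇒2≤ 1≤m {C} j {Y} isC odd v∈C dom B∩X⊆Y =
      +-cancelʳ-≤ (length C) 2 (length Y) (begin
        suc (suc (length C))   ≤⟨ s≤s (odd<2* odd) ⟩
        suc (2 * (3 * m))      ≡⟨ sym (length-blockOf 1≤m j) ⟩
        length (blockOf j)     ≤⟨ dominated-length≤ isC v∈C (unique-blockOf j) dom B∩X⊆Y ⟩
        length C + length Y    ≡⟨ +-comm (length C) (length Y) ⟩
        length Y + length C    ∎)
      where open ≤-Reasoning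

    dominated-bound : 1 ≤ m → ∀ {v} j {Y Cs} → v ∉ X → All (Dominates v) (blockOf j) →
      (∀ {w} → w ∈ blockOf j → w ∈ X → w ∈ Y) →
      All (IsComponent X) Cs → All (OddBelow (3 * m) ∘ length) Cs →
      AllPairs (λ C D → ¬ SameSet C D) Cs → All (λ C → Dominates v (first C)) Cs →
      Bound m (length Cs) (length Y) 1
    dominated-bound 1≤m {v} j {Y} {Cs} v∉X dom B∩X⊆Y comps odds distinct near =
      bound-≤1 m (at-most-one-component-through comps distinct v∈Cs) (two-in-Y comps odds v∈Cs)
      where
      v∈Cs : All (v ∈_) Cs
      v∈Cs = All.zipWith
        (λ (isC , near-C) → dominated-∈ isC (first∈ isC) v∉X (dominates-sym near-C)) (comps , near)
      two-in-Y : ∀ {Cs} → All (IsComponent X) Cs → All (OddBelow (3 * m) ∘ length) Cs →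
        All (v ∈_) Cs → 1 ≤ length Cs → 2 ≤ length Y
      two-in-Y (isC ∷ _) (odd ∷ _) (v∈C ∷ _) _ = dominated-component⇒2≤ 1≤m j isC odd v∈C dom B∩X⊆Y

  module _ {X : List (V n m)} (R₀⊆X : ∀ a → r0 a ∈ X) {j} (K⊆X : ∀ a → kv j a ∈ X) where

    reach-within-pair : ∀ {p s u} → Reach X (pv j p s) u → u ∈ pairOf j p
    reach-within-pair {p} {s} here = pv∈pairOf j p s
    reach-within-pair (step {w = r0 a} _ w∉X _) = ⊥-elim (w∉X (R₀⊆X a))
    reach-within-pair (step {w = kv _ a} refl w∉X _) = ⊥-elim (w∉X (K⊆X a))
    reach-within-pair (step {w = pv _ _ _} (refl , refl , _) _ r) = reach-within-pair r

    -- Otherwise the component would be exactly the copy of P₂, of even size 2.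
    partner-∈X : ∀ {C k p s} → IsComponent X C → OddBelow k (length C) → pv j p s ∈ C →
      pv j p (other s) ∈ X
    partner-∈X {C} {k} {p} {s} isC odd v∈C with pv j p (other s) ∈? X
    ... | yes w∈X = w∈X
    ... | no w∉X = ⊥-elim (¬odd-2 (subst (OddBelow k) length≡2 odd))
      where
      C⊆pair : C ⊆ pairOf j p
      C⊆pair u∈C = reach-within-pair (component-connected isC v∈C u∈C)
      pair⊆C : pv j p s ∷ pv j p (other s) ∷ [] ⊆ C
      pair⊆C (here refl) = v∈C
      pair⊆C (there (here refl)) = component-closed isC v∈C (refl , refl , ≢-other s) w∉X
      length≡2 : length C ≡ 2
      length≡2 = ≤-antisym (unique-⊆⇒length≤ _≟V_ (component-unique isC) C⊆pair)
                           (unique-⊆⇒length≤ _≟V_ (unique-pairOf j p s) pair⊆C)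

    Pendant : V n m → Set
    Pendant v = v ∈ matchingOf j × v ∉ X × partner v ∈ X

    first-pendant : ∀ {C k} → IsComponent X C → OddBelow k (length C) → block (first C) ≡ toℕ j →
      Pendant (first C)
    first-pendant {C} isC odd eq with block≡⇒kv⊎pv (first C) eq
    ... | inj₁ (a , first≡) =
      ⊥-elim (component-avoids isC (first∈ isC) (subst (_∈ X) (sym first≡) (K⊆X a)))
    ... | inj₂ (p , s , first≡) = subst Pendant (sym first≡)
      (pv∈matchingOf j p s , component-avoids isC (subst (_∈ C) first≡ (first∈ isC)) ,
       partner-∈X isC odd (subst (_∈ C) first≡ (first∈ isC)))

    pendant-bound : 1 ≤ m → ∀ {Y Cs} → (∀ {w} → w ∈ blockOf j → w ∈ X → w ∈ Y) →
      All (IsComponent X) Cs → All (OddBelow (3 * m) ∘ length) Cs →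
      AllPairs (λ C D → ¬ SameSet C D) Cs → All (λ C → block (first C) ≡ toℕ j) Cs →
      Bound m (length Cs) (length Y) 1
    pendant-bound 1≤m {Y} {Cs} B∩X⊆Y comps odds distinct in-block =
      bound-pendants m 1≤m
        (subst₂ _≤_ (cong₂ _+_ length-firsts length-partners) (length-matchingOf j)
          (disjoint-⊆⇒length-+≤ _≟V_ unique-firsts unique-partners firsts#partners
            (proj₁ ∘ All.lookup pendants) (proj₁ ∘ All.lookup matched)))
        (subst (_≤ length Y) (cong₂ _+_ (length-cliqueOf j) length-partners)
          (disjoint-⊆⇒length-+≤ _≟V_ (unique-cliqueOf j) unique-partners clique#partners
            clique⊆Y partners⊆Y))
      where
      firsts partners : List (V n m)
      firsts = map first Cs
      partners = map partner firsts

      length-firsts : length firsts ≡ length Cs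
      length-firsts = length-map first Cs
      length-partners : length partners ≡ length Cs
      length-partners = trans (length-map partner firsts) length-firsts

      pendants : All Pendant firsts
      pendants = Allₚ.map⁺ (All.zipWith (λ (isC , odd , eq) → first-pendant isC odd eq)
        (comps , All.zip (odds , in-block)))
      matched : All (λ w → w ∈ matchingOf j × w ∈ X) partners
      matched = Allₚ.map⁺ (All.map (λ (w∈M , _ , w′∈X) → partner-∈matchingOf w∈M , w′∈X) pendants)

      unique-firsts : Unique firsts
      unique-firsts = distinct-components-distinct-firsts comps distinct
      unique-partners : Unique partners
      unique-partners = Uniqueₚ.map⁺ partner-injective unique-firsts

      firsts#partners : Disjoint firsts partners
      firsts#partners (w∈F , w∈P) =
        proj₁ (proj₂ (All.lookup pendants w∈F)) (proj₂ (All.lookup matched w∈P))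
      clique#partners : Disjoint (cliqueOf j) partners
      clique#partners (w∈K , w∈P) =
        cliqueOf-disjoint-matchingOf j (w∈K , proj₁ (All.lookup matched w∈P))

      clique⊆Y : cliqueOf j ⊆ Y
      clique⊆Y w∈K with ∈-cliqueOf⁻ w∈K
      ... | a , refl = B∩X⊆Y (∈-++⁺ˡ w∈K) (K⊆X a)
      partners⊆Y : partners ⊆ Y
      partners⊆Y w∈P with All.lookup matched w∈P
      ... | w∈M , w∈X = B∩X⊆Y (∈-++⁺ʳ (cliqueOf j) w∈M) w∈X

  module _ (1≤m : 1 ≤ m) {X : List (V n m)} (uX : Unique X) {Cs : List (List (V n m))}
    (comps : All (IsComponent X) Cs) (odds : All (OddBelow (3 * m) ∘ length) Cs)
    (distinct : AllPairs (λ C D → ¬ SameSet C D) Cs) where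

    bound-if-R₀-survives : ∀ a → r0 a ∉ X → Bound m (length Cs) (length X) 1
    bound-if-R₀-survives a a∉X =
      dominated-bound 1≤m Fin.zero a∉X (All.tabulate (λ {w} _ → r0-dominates a w)) (λ _ w∈X → w∈X)
        comps odds distinct (All.tabulate (λ {C} _ → r0-dominates a (first C)))

    module _ (R₀⊆X : ∀ a → r0 a ∈ X) where

      bound-at-block : ∀ j →
        Bound m (countAt (block ∘ first) (toℕ j) Cs) (countAt block (toℕ j) X) 1
      bound-at-block j = by-cases (all? (λ a → kv j a ∈? X))
        where
        in-block? : ∀ C → Dec (block (first C) ≡ toℕ j)
        in-block? C = block (first C) ℕ.≟ toℕ j
        Csⱼ : List (List (V n m))
        Csⱼ = filter in-block? Cs
        Xⱼ : List (V n m)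
        Xⱼ = filter (λ v → block v ℕ.≟ toℕ j) X
        B∩X⊆Xⱼ : ∀ {w} → w ∈ blockOf j → w ∈ X → w ∈ Xⱼ
        B∩X⊆Xⱼ w∈B w∈X = ∈-filter⁺ _ w∈X (block-∈blockOf w∈B)
        comps-at : All (IsComponent X) Csⱼ
        comps-at = Allₚ.filter⁺ in-block? comps
        odds-at : All (OddBelow (3 * m) ∘ length) Csⱼ
        odds-at = Allₚ.filter⁺ in-block? odds
        distinct-at : AllPairs (λ C D → ¬ SameSet C D) Csⱼ
        distinct-at = AllPairsₚ.filter⁺ in-block? distinct
        by-cases : Dec (∀ a → kv j a ∈ X) → Bound m (length Csⱼ) (length Xⱼ) 1
        by-cases (yes K⊆X) = pendant-bound R₀⊆X K⊆X 1≤m B∩X⊆Xⱼ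
          comps-at odds-at distinct-at (Allₚ.all-filter in-block? Cs)
        by-cases (no K⊈X) with ¬∀⟶∃¬ _ _ (λ a → kv j a ∈? X) K⊈X
        ... | a , a∉X = dominated-bound 1≤m j a∉X
          (All.tabulate (λ {w} w∈B → kv-dominates j a w (block-∈blockOf w∈B)))
          B∩X⊆Xⱼ comps-at odds-at distinct-at
          (All.map (kv-dominates j a _) (Allₚ.all-filter in-block? Cs))

      block<2n+1 : ∀ {v} → v ∉ X → block v < suc (2 * n)
      block<2n+1 {r0 a} v∉X = ⊥-elim (v∉X (R₀⊆X a))
      block<2n+1 {kv i _} _ = toℕ<n i
      block<2n+1 {pv i _ _} _ = toℕ<n i

      all-components-in-blocks : countBelow (block ∘ first) (suc (2 * n)) Cs ≡ length Cs
      all-components-in-blocks = cong length (filter-all _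
        (All.map (λ isC → block<2n+1 (component-avoids isC (first∈ isC))) comps))

      R₀-outside-blocks : countBelow block (suc (2 * n)) X + n ≤ length X
      R₀-outside-blocks = subst (λ r → countBelow block (suc (2 * n)) X + r ≤ length X) length-R₀
        (disjoint-⊆⇒length-+≤ _≟V_ (Uniqueₚ.filter⁺ _ uX) unique-R₀ blocks#R₀
          (proj₁ ∘ ∈-filter⁻ _) R₀⊆X′)
        where
        R₀ : List (V n m)
        R₀ = map r0 (allFin n)
        length-R₀ : length R₀ ≡ n
        length-R₀ = trans (length-map r0 (allFin n)) (length-allFin n)
        unique-R₀ : Unique R₀
        unique-R₀ = Uniqueₚ.map⁺ (λ { refl → refl }) (Uniqueₚ.allFin⁺ n)
        blocks#R₀ : Disjoint (filter (λ v → block v <? suc (2 * n)) X) R₀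
        blocks#R₀ (w∈F , w∈R₀)
          with ∈-map⁻ r0 w∈R₀ | ∈-filter⁻ (λ v → block v <? suc (2 * n)) {xs = X} w∈F
        ... | _ , _ , refl | _ , block< = <-irrefl refl block<
        R₀⊆X′ : R₀ ⊆ X
        R₀⊆X′ w∈R₀ with ∈-map⁻ r0 w∈R₀
        ... | a , _ , refl = R₀⊆X a

      bound-if-R₀⊆X : Bound m (length Cs) (length X) 1
      bound-if-R₀⊆X = bound-absorb m n
        (subst (λ c → Bound m c _ _) all-components-in-blocks
          (bound-sum m (block ∘ first) block Cs X (suc (2 * n)) λ k k<N →
            subst (λ k → Bound m (countAt (block ∘ first) k Cs) (countAt block k X) 1)
              (toℕ-fromℕ< k<N) (bound-at-block (fromℕ< k<N))))
        R₀-outside-blocks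

lemma3 : (m : ℕ) → 1 ≤ m → (n : ℕ) → 1 ≤ n →
    (X : List (V n m)) → Unique X →
    (Cs : List (List (V n m))) →
    All (IsComponent X) Cs →
    All (λ C → OddBelow (3 * m) (length C)) Cs →
    AllPairs (λ C D → ¬ SameSet C D) Cs →
    (8 * (3 * m) + 3) * length Cs ≤ (4 * (3 * m) + 6) * length X + (2 * (3 * m) + 3)
lemma3 m 1≤m n _ X uX Cs comps odds distinct = bound⇒theorem m bound
  where
  bound : Bound m (length Cs) (length X) 1
  bound with all? (λ a → r0 a ∈? X)
  ... | yes R₀⊆X = bound-if-R₀⊆X 1≤m uX comps odds distinct R₀⊆X
  ... | no R₀⊈X with ¬∀⟶∃¬ _ _ (λ a → r0 a ∈? X) R₀⊈X
  ...   | a , a∉X = bound-if-R₀-survives 1≤m uX comps odds distinct a a∉X
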